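{- In $\mathbf{uGraph}$, let $A$ be a finite undirected multigraph with an edge $e\in E_A$ such that removing $e$ from $A$ yields the disjoint union $A_1+A_2$ of two subgraphs $A_1,A_2$ with $e$ joining $A_1$ to $A_2$ (i.e. $e$ is a bridge), and let $A_1+A_2\hookrightarrow A$ be the inclusion. Let $\beta_j:A_j\hookrightarrow B_j$ ($j=1,2$) be $\mathcal{M}$-morphisms and let $B$ be the pushout of $A\hookleftarrow A_1+A_2\xrightarrow{[\beta_1,\beta_2]}B_1+B_2$. Then $$\mathsf{Shift}\big(A_1+A_2\xrightarrow{[\beta_1,\beta_2]}B_1+B_2,\ \neg\exists(A_1+A_2\hookrightarrow A)\big)=\neg\exists(B_1+B_2\hookrightarrow B).$$
   Context: $\mathbf{uGraph}$: objects are finite undirected multigraphs $G=(E_G,V_G,i_G)$ with $i_G:E_G\to\mathcal{P}^{(1,2)}(V_G)$ assigning to each edge its set of one or two endpoints; morphisms are pairs $(\varphi_E,\varphi_V)$ of functions with $i_{G'}\circ\varphi_E=\mathcal{P}^{(1,2)}(\varphi_V)\circ i_G$; $\mathcal{M}$ is the class of component-wise injective morphisms; $+$ denotes disjoint union (coproduct). Conditions over a graph $X$ are defined recursively: $\mathsf{true}_X$; $\exists(f,c_Y)$ for $f:X\to Y$ in $\mathcal{M}$ and a condition $c_Y$ over $Y$ ($\exists(f):=\exists(f,\mathsf{true}_Y)$); $\neg c_X$; $c_X^{(1)}\wedge c_X^{(2)}$. A morphism $h:X\to Z$ in $\mathcal{M}$ satisfies $\exists(f,c_Y)$ iff $h=g\circ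 f$ for some $g:Y\to Z$ in $\mathcal{M}$ with $g\models c_Y$; negation and conjunction are classical. $\mathsf{Shift}$ is computed by the recursive algorithm: $\mathsf{Shift}(y,\mathsf{true})=\mathsf{true}$; $\mathsf{Shift}(y,\neg c)=\neg\mathsf{Shift}(y,c)$; $\mathsf{Shift}(y,c\wedge c')=\mathsf{Shift}(y,c)\wedge\mathsf{Shift}(y,c')$; and for $y:X\to Y$, $a:X\to A$ in $\mathcal{M}$, $\mathsf{Shift}(y,\exists(a,c_A))=\bigvee\exists(\bar a,\mathsf{Shift}(\bar y,c_A))$ over all triples $(a',x',y')$ of $\mathcal{M}$-morphisms $x':X\to X'$, $a':X'\to A$, $y':X'\to Y$ with $a'\circ x'=a$ and $y'\circ x'=y$ (up to isomorphism), where $Y\xrightarrow{\bar a}A_{X'}\xleftarrow{\bar y}A$ is the pushout of $A\xleftarrow{a'}X'\xrightarrow{y'}Y$; it satisfies: for all $g:Y\to Z$ in $\mathcal{M}$, $g\circ y\models c_X$ iff $g\models\mathsf{Shift}(y,c_X)$. -}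

module Defs where

open import Data.Nat using (ℕ; _+_)
open import Data.Fin using (Fin; _↑ˡ_; _↑ʳ_; splitAt; join)
open import Data.Fin.Properties using (splitAt-join; join-splitAt)
open import Data.Sum.Properties using (inj₁-injective; inj₂-injective)
open import Data.Sum using (_⊎_; inj₁; inj₂) renaming (map to ⊎-map)
open import Data.Product using (Σ; Σ-syntax; _×_; _,_; proj₁; proj₂)
open import Data.Unit using (⊤)
open import Data.List using (List; []; _∷_; map)
open import Data.List.Relation.Unary.Any using (Any)
open import Data.List.Relation.Unary.AllPairs using (AllPairs)
open import Relation.Binary.PropositionalEquality
open import Relation.Nullary using (¬_)
open import Function using (_∘_; id)
open import Function.Definitions using (Injective)

-- Finite undirected multigraphs.  Edges are Fin nE, vertices Fin nV.
-- The endpoint set i_G(e) ∈ P^(1,2)(V) is {end₁ e , end₂ e}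
-- (a one-element set, i.e. a loop, when end₁ e ≡ end₂ e).

record Graph : Set where
  field
    nE nV : ℕ
    end₁ end₂ : Fin nE → Fin nV
open Graph public

SameEnds : ∀ {n} → Fin n → Fin n → Fin n → Fin n → Set
SameEnds a b c d = (a ≡ c × b ≡ d) ⊎ (a ≡ d × b ≡ c)

SameEnds-map : ∀ {m n} (h : Fin m → Fin n) {a b c d} →
               SameEnds a b c d → SameEnds (h a) (h b) (h c) (h d)
SameEnds-map h (inj₁ (p , q)) = inj₁ (cong h p , cong h q)
SameEnds-map h (inj₂ (p , q)) = inj₂ (cong h p , cong h q)

SameEnds-trans : ∀ {n} {a b c d e f : Fin n} →
                 SameEnds a b c d → SameEnds c d e f → SameEnds a b e f
SameEnds-trans (inj₁ (p , q)) (inj₁ (r , s)) = inj₁ (trans p r , trans q s)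
SameEnds-trans (inj₁ (p , q)) (inj₂ (r , s)) = inj₂ (trans p r , trans q s)
SameEnds-trans (inj₂ (p , q)) (inj₁ (r , s)) = inj₂ (trans p s , trans q r)
SameEnds-trans (inj₂ (p , q)) (inj₂ (r , s)) = inj₁ (trans p s , trans q r)

-- morphisms of uGraph: i_H ∘ φ_E = P^(1,2)(φ_V) ∘ i_G
record Mor (G H : Graph) : Set where
  field
    fE : Fin (nE G) → Fin (nE H)
    fV : Fin (nV G) → Fin (nV H)
    compat : ∀ e → SameEnds (fV (end₁ G e)) (fV (end₂ G e))
                            (end₁ H (fE e)) (end₂ H (fE e))
open Mor public

idM : ∀ {G} → Mor G G
idM = record { fE = id ; fV = id ; compat = λ e → inj₁ (refl , refl) }

_∘M_ : ∀ {G H K} → Mor H K → Mor G H → Mor G K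
_∘M_ {G} {H} {K} g f = record
  { fE = fE g ∘ fE f
  ; fV = fV g ∘ fV f
  ; compat = λ e → SameEnds-trans (SameEnds-map (fV g) (compat f e))
                                  (compat g (fE f e))
  }

_≈M_ : ∀ {G H} → Mor G H → Mor G H → Set
f ≈M g = (∀ e → fE f e ≡ fE g e) × (∀ v → fV f v ≡ fV g v)

record MMor (G H : Graph) : Set where
  field
    mor : Mor G H
    injE : Injective _≡_ _≡_ (fE mor)
    injV : Injective _≡_ _≡_ (fV mor)
open MMor public

_∘𝓜_ : ∀ {G H K} → MMor H K → MMor G H → MMor G K
g ∘𝓜 f = record
  { mor = mor g ∘M mor f
  ; injE = λ p → injE f (injE g p)
  ; injV = λ p → injV f (injV g p)
  }

_⊕f_ : ∀ {m₁ m₂ n₁ n₂} → (Fin m₁ → Fin n₁) → (Fin m₂ → Fin n₂) →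
       Fin (m₁ + m₂) → Fin (n₁ + n₂)
_⊕f_ {m₁} {m₂} {n₁} {n₂} f g k = join n₁ n₂ (⊎-map f g (splitAt m₁ k))

⊕f-inj : ∀ {m₁ m₂ n₁ n₂} (f : Fin m₁ → Fin n₁) (g : Fin m₂ → Fin n₂) →
         Injective _≡_ _≡_ f → Injective _≡_ _≡_ g → Injective _≡_ _≡_ (f ⊕f g)
⊕f-inj {m₁} {m₂} {n₁} {n₂} f g fi gi {x} {y} p =
  trans (sym (join-splitAt m₁ m₂ x))
    (trans (cong (join m₁ m₂) (lem (splitAt m₁ x) (splitAt m₁ y)
       (trans (sym (splitAt-join n₁ n₂ _))
         (trans (cong (splitAt n₁) p) (splitAt-join n₁ n₂ _)))))
       (join-splitAt m₁ m₂ y))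
  where
  lem : ∀ u v → ⊎-map f g u ≡ ⊎-map f g v → u ≡ v
  lem (inj₁ a) (inj₁ b) q = cong inj₁ (fi (inj₁-injective q))
  lem (inj₁ a) (inj₂ b) ()
  lem (inj₂ a) (inj₁ b) ()
  lem (inj₂ a) (inj₂ b) q = cong inj₂ (gi (inj₂-injective q))

_⊕_ : Graph → Graph → Graph
G ⊕ H = record
  { nE = nE G + nE H
  ; nV = nV G + nV H
  ; end₁ = end₁ G ⊕f end₁ H
  ; end₂ = end₂ G ⊕f end₂ H
  }

inlV : ∀ {G} H → Fin (nV G) → Fin (nV (G ⊕ H))
inlV H v = v ↑ˡ nV H

inrV : ∀ G {H} → Fin (nV H) → Fin (nV (G ⊕ H))
inrV G v = nV G ↑ʳ v

_⊕M_ : ∀ {G₁ G₂ H₁ H₂} → Mor G₁ H₁ → Mor G₂ H₂ → Mor (G₁ ⊕ G₂) (H₁ ⊕ H₂)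
_⊕M_ {G₁} {G₂} {H₁} {H₂} f g = record
  { fE = fE f ⊕f fE g
  ; fV = fV f ⊕f fV g
  ; compat = cp
  }
  where
  cp : ∀ k → SameEnds ((fV f ⊕f fV g) ((end₁ G₁ ⊕f end₁ G₂) k))
                      ((fV f ⊕f fV g) ((end₂ G₁ ⊕f end₂ G₂) k))
                      ((end₁ H₁ ⊕f end₁ H₂) ((fE f ⊕f fE g) k))
                      ((end₂ H₁ ⊕f end₂ H₂) ((fE f ⊕f fE g) k))
  cp k with splitAt (nE G₁) k
  ... | inj₁ e
    rewrite splitAt-join (nV G₁) (nV G₂) (inj₁ (end₁ G₁ e))
          | splitAt-join (nV G₁) (nV G₂) (inj₁ (end₂ G₁ e))
          | splitAt-join (nE H₁) (nE H₂) (inj₁ (fE f e))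
          = SameEnds-map (λ v → join (nV H₁) (nV H₂) (inj₁ v)) (compat f e)
  ... | inj₂ e
    rewrite splitAt-join (nV G₁) (nV G₂) (inj₂ (end₁ G₂ e))
          | splitAt-join (nV G₁) (nV G₂) (inj₂ (end₂ G₂ e))
          | splitAt-join (nE H₁) (nE H₂) (inj₂ (fE g e))
          = SameEnds-map (λ v → join (nV H₁) (nV H₂) (inj₂ v)) (compat g e)

_⊕𝓜_ : ∀ {G₁ G₂ H₁ H₂} → MMor G₁ H₁ → MMor G₂ H₂ → MMor (G₁ ⊕ G₂) (H₁ ⊕ H₂)
f ⊕𝓜 g = record
  { mor = mor f ⊕M mor g
  ; injE = ⊕f-inj (fE (mor f)) (fE (mor g)) (injE f) (injE g)
  ; injV = ⊕f-inj (fV (mor f)) (fV (mor g)) (injV f) (injV g)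
  }

-- Pushouts in uGraph (universal property, w.r.t. all morphisms):
-- the square  X --f--> A --p--> P  =  X --g--> Y --q--> P  is a pushout.

record IsPushout {X A Y P : Graph} (f : Mor X A) (g : Mor X Y)
                 (p : Mor A P) (q : Mor Y P) : Set where
  field
    commutes : (p ∘M f) ≈M (q ∘M g)
    universal : ∀ (Z : Graph) (u : Mor A Z) (v : Mor Y Z) → (u ∘M f) ≈M (v ∘M g) →
                Σ[ h ∈ Mor P Z ] (((h ∘M p) ≈M u × (h ∘M q) ≈M v) ×
                  (∀ (h' : Mor P Z) → (h' ∘M p) ≈M u → (h' ∘M q) ≈M v → h' ≈M h))

data Cond (X : Graph) : Set where
  trueC : Cond X
  ∃C    : ∀ {Y : Graph} → MMor X Y → Cond Y → Cond X
  ¬C    : Cond X → Cond X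
  _∧C_  : Cond X → Cond X → Cond X

falseC : ∀ {X} → Cond X
falseC = ¬C trueC

_∨C_ : ∀ {X} → Cond X → Cond X → Cond X
c ∨C d = ¬C (¬C c ∧C ¬C d)

⋁C : ∀ {X} → List (Cond X) → Cond X
⋁C [] = falseC
⋁C (c ∷ cs) = c ∨C ⋁C cs

_⊨_ : ∀ {X Z : Graph} → MMor X Z → Cond X → Set
h ⊨ trueC = ⊤
_⊨_ {Z = Z} h (∃C {Y} f c) =
  Σ[ g ∈ MMor Y Z ] ((mor (g ∘𝓜 f) ≈M mor h) × (g ⊨ c))
h ⊨ ¬C c = ¬ (h ⊨ c)
h ⊨ (c ∧C d) = (h ⊨ c) × (h ⊨ d)

-- The Shift algorithm, as the relation "Shifts y c c'" :
-- c' is a possible result of the recursive algorithm Shift(y, c).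
-- (The result depends on choices of iso-representatives, of pushout
-- objects and of the order of the disjunction, hence a relation.)

record Triple {X A Y : Graph} (a : MMor X A) (y : MMor X Y) : Set where
  field
    X' : Graph
    x' : MMor X X'
    a' : MMor X' A
    y' : MMor X' Y
    a'x' : mor (a' ∘𝓜 x') ≈M mor a
    y'x' : mor (y' ∘𝓜 x') ≈M mor y
open Triple public

record TripleIso {X A Y : Graph} {a : MMor X A} {y : MMor X Y}
                 (t₁ t₂ : Triple a y) : Set where
  field
    φ : Mor (X' t₁) (X' t₂)
    ψ : Mor (X' t₂) (X' t₁)
    ψφ : (ψ ∘M φ) ≈M idM
    φψ : (φ ∘M ψ) ≈M idM
    φx' : (φ ∘M mor (x' t₁)) ≈M mor (x' t₂)
    a'φ : (mor (a' t₂) ∘M φ) ≈M mor (a' t₁)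
    y'φ : (mor (y' t₂) ∘M φ) ≈M mor (y' t₁)

data Shifts {X Y : Graph} (y : MMor X Y) : Cond X → Cond Y → Set

-- one disjunct  ∃(ā, Shift(ȳ, c_A))  for a triple, where
-- Y --ā--> P <--ȳ-- A  is a pushout of  A <--a'-- X' --y'--> Y
record Branch {X Y A : Graph} (y : MMor X Y) (a : MMor X A) (cA : Cond A) : Set where
  inductive
  field
    triple : Triple a y
    P : Graph
    ā : MMor Y P
    ȳ : MMor A P
    pushout : IsPushout (mor (a' triple)) (mor (y' triple)) (mor ȳ) (mor ā)
    shifted : Cond P
    shift-rec : Shifts ȳ cA shifted
  result : Cond Y
  result = ∃C ā shifted

data Shifts {X} {Y} y where
  sh-true : Shifts y trueC trueC
  sh-¬ : ∀ {c c'} → Shifts y c c' → Shifts y (¬C c) (¬C c')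
  sh-∧ : ∀ {c d c' d'} → Shifts y c c' → Shifts y d d' →
         Shifts y (c ∧C d) (c' ∧C d')
  sh-∃ : ∀ {A} {a : MMor X A} {cA : Cond A} (bs : List (Branch y a cA)) →
         (∀ (t : Triple a y) → Any (λ b → TripleIso t (Branch.triple b)) bs) →
         AllPairs (λ b b' → ¬ TripleIso (Branch.triple b) (Branch.triple b')) bs →
         Shifts y (∃C a cA) (⋁C (map Branch.result bs))

record IsBridgeRemoval (A₁ A₂ A : Graph) (ι : MMor (A₁ ⊕ A₂) A)
                       (e : Fin (nE A)) : Set where
  field
    vertices-onto : ∀ (v : Fin (nV A)) →
                    Σ[ w ∈ Fin (nV (A₁ ⊕ A₂)) ] fV (mor ι) w ≡ v
    e-not-hit : ∀ (d : Fin (nE (A₁ ⊕ A₂))) → ¬ (fE (mor ι) d ≡ e)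
    others-hit : ∀ (d : Fin (nE A)) → ¬ (d ≡ e) →
                 Σ[ d' ∈ Fin (nE (A₁ ⊕ A₂)) ] fE (mor ι) d' ≡ d
    e-joins : Σ[ v₁ ∈ Fin (nV A₁) ] Σ[ v₂ ∈ Fin (nV A₂) ]
                SameEnds (end₁ A e) (end₂ A e)
                         (fV (mor ι) (inlV {A₁} A₂ v₁)) (fV (mor ι) (inrV A₁ {A₂} v₂))

{-# OPTIONS --safe #-}
-- Removing the bridge e from A leaves A₁ + A₂, while B₁ + B₂ has no edge between its two
-- summands. So in a factorisation ι = a' ∘ x', β₁ + β₂ = y' ∘ x' no edge of X' is sent to e
-- by a' (y' would send it to an edge joining the summands); since ι hits every vertex of A
-- and every edge other than e, x' is bijective. Hence every triple of Shift is isomorphic to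
-- the trivial one, the pushout of each disjunct is isomorphic to B under B₁ + B₂, and there
-- is at least one disjunct, so the shifted condition is equivalent to ¬∃(B₁ + B₂ ↪ B).
-- The leg A → B lies in 𝓜 because its composite with the mediating map into B₁ + B₂ with
-- the bridge glued back in is injective.
module Submission where

open import Defs
open import Data.Nat using (suc)
open import Data.Fin using (Fin; zero; suc; _↑ˡ_; _↑ʳ_; splitAt; join)
open import Data.Fin.Properties using (splitAt-↑ˡ; splitAt-↑ʳ; suc-injective; _≟_)
import Data.Vec.Functional as Vector
open import Data.Product using (Σ-syntax; _×_; _,_; proj₁; proj₂)
open import Data.Sum using (inj₁; inj₂) renaming (map to ⊎-map)
open import Data.Unit using (tt)
open import Data.Empty using (⊥-elim)
open import Data.List using (List; []; _∷_)
open import Data.List.Relation.Unary.Any as Any using (Any; here; there)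
import Data.List.Relation.Unary.Any.Properties as Anyₚ
open import Data.List.Relation.Unary.All as All using (All; []; _∷_)
import Data.List.Relation.Unary.All.Properties as Allₚ
open import Data.List.Relation.Unary.AllPairs using ([]; _∷_)
open import Relation.Binary.PropositionalEquality
open import Relation.Binary.Bundles using (Setoid)
import Relation.Binary.Reasoning.Setoid as SetoidReasoning
open import Relation.Nullary using (¬_; yes; no)
open import Level using (0ℓ)
open import Function
  using (_∘_; id; Injective; StrictlySurjective; _⇔_; mk⇔; Equivalence)

SameEnds-sym : ∀ {n} {a b c d : Fin n} → SameEnds a b c d → SameEnds c d a b
SameEnds-sym (inj₁ (p , q)) = inj₁ (sym p , sym q)
SameEnds-sym (inj₂ (p , q)) = inj₂ (sym q , sym p)

SameEnds-injective : ∀ {m n} {h : Fin m → Fin n} → Injective _≡_ _≡_ h →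
                     ∀ {a b c d} → SameEnds (h a) (h b) (h c) (h d) → SameEnds a b c d
SameEnds-injective h-inj (inj₁ (p , q)) = inj₁ (h-inj p , h-inj q)
SameEnds-injective h-inj (inj₂ (p , q)) = inj₂ (h-inj p , h-inj q)

SameEnds-subst : ∀ {n} {a b c d a' b' c' d' : Fin n} →
                 a ≡ a' → b ≡ b' → c ≡ c' → d ≡ d' → SameEnds a b c d → SameEnds a' b' c' d'
SameEnds-subst refl refl refl refl s = s

-- Oriented so that  compat f d : Joins H (fE f d) (fV f (end₁ G d)) (fV f (end₂ G d)).
Joins : (G : Graph) → Fin (nE G) → Fin (nV G) → Fin (nV G) → Set
Joins G d u w = SameEnds u w (end₁ G d) (end₂ G d)

Joins-subst : ∀ {G d d' u u' w w'} → d ≡ d' → u ≡ u' → w ≡ w' → Joins G d u w → Joins G d' u' w'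
Joins-subst refl refl refl j = j

Joins-map : ∀ {G H} (f : Mor G H) {d u w} → Joins G d u w → Joins H (fE f d) (fV f u) (fV f w)
Joins-map f {d} j = SameEnds-trans (SameEnds-map (fV f) j) (compat f d)

Joins-reflect : ∀ {G H} (m : MMor G H) {d u w} →
                Joins H (fE (mor m) d) (fV (mor m) u) (fV (mor m) w) → Joins G d u w
Joins-reflect m {d} j =
  SameEnds-injective (injV m) (SameEnds-trans j (SameEnds-sym (compat (mor m) d)))

↑ˡ≢↑ʳ : ∀ {m n} (i : Fin m) (j : Fin n) → i ↑ˡ n ≢ m ↑ʳ j
↑ˡ≢↑ʳ {m} {n} i j p
  with () ← trans (sym (splitAt-↑ˡ m i n)) (trans (cong (splitAt m) p) (splitAt-↑ʳ m n j))

⊕f-↑ˡ : ∀ {m₁ m₂ n₁ n₂} (f : Fin m₁ → Fin n₁) (g : Fin m₂ → Fin n₂) i →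
        (f ⊕f g) (i ↑ˡ m₂) ≡ f i ↑ˡ n₂
⊕f-↑ˡ {m₁} {m₂} {n₁} {n₂} f g i = cong (join n₁ n₂ ∘ ⊎-map f g) (splitAt-↑ˡ m₁ i m₂)

⊕f-↑ʳ : ∀ {m₁ m₂ n₁ n₂} (f : Fin m₁ → Fin n₁) (g : Fin m₂ → Fin n₂) i →
        (f ⊕f g) (m₁ ↑ʳ i) ≡ n₁ ↑ʳ g i
⊕f-↑ʳ {m₁} {m₂} {n₁} {n₂} f g i = cong (join n₁ n₂ ∘ ⊎-map f g) (splitAt-↑ʳ m₁ m₂ i)

⊕-no-crossing-edge : ∀ G H d u w → ¬ Joins (G ⊕ H) d (inlV {G} H u) (inrV G {H} w)
⊕-no-crossing-edge G H d u w with splitAt (nE G) d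
... | inj₁ d = λ { (inj₁ (_ , q)) → ↑ˡ≢↑ʳ (end₂ G d) w (sym q)
                 ; (inj₂ (_ , q)) → ↑ˡ≢↑ʳ (end₁ G d) w (sym q) }
... | inj₂ d = λ { (inj₁ (p , _)) → ↑ˡ≢↑ʳ u (end₁ H d) p
                 ; (inj₂ (p , _)) → ↑ˡ≢↑ʳ u (end₂ H d) p }

≈M-refl : ∀ {G H} {f : Mor G H} → f ≈M f
≈M-refl = (λ _ → refl) , (λ _ → refl)

≈M-sym : ∀ {G H} {f g : Mor G H} → f ≈M g → g ≈M f
≈M-sym (p , q) = (λ x → sym (p x)) , (λ x → sym (q x))

≈M-trans : ∀ {G H} {f g h : Mor G H} → f ≈M g → g ≈M h → f ≈M h
≈M-trans (p , q) (r , s) = (λ x → trans (p x) (r x)) , (λ x → trans (q x) (s x))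

≈M-setoid : Graph → Graph → Setoid 0ℓ 0ℓ
≈M-setoid G H = record
  { Carrier = Mor G H
  ; _≈_ = _≈M_
  ; isEquivalence = record
    { refl = λ {f} → ≈M-refl {f = f}
    ; sym = λ {f g} → ≈M-sym {f = f} {g}
    ; trans = λ {f g h} → ≈M-trans {f = f} {g} {h}
    }
  }

module ≈M-Reasoning {G H : Graph} = SetoidReasoning (≈M-setoid G H)

-- A morphism occurring only under _≈M_ cannot be inferred (its compat field is
-- unconstrained), so such arguments of the lemmas below are always given explicitly.

∘M-congˡ : ∀ {G H K} (h : Mor H K) {f g : Mor G H} → f ≈M g → (h ∘M f) ≈M (h ∘M g)
∘M-congˡ h (p , q) = (λ x → cong (fE h) (p x)) , (λ x → cong (fV h) (q x))

∘M-congʳ : ∀ {G H K} (h : Mor G H) {f g : Mor H K} → f ≈M g → (f ∘M h) ≈M (g ∘M h)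
∘M-congʳ h (p , q) = (λ x → p (fE h x)) , (λ x → q (fV h x))

_∈𝓜 : ∀ {G H} → Mor G H → Set
f ∈𝓜 = Injective _≡_ _≡_ (fE f) × Injective _≡_ _≡_ (fV f)

as𝓜 : ∀ {G H} (f : Mor G H) → f ∈𝓜 → MMor G H
as𝓜 f (f-injE , f-injV) = record { mor = f ; injE = f-injE ; injV = f-injV }

id𝓜 : ∀ {G} → MMor G G
id𝓜 = as𝓜 idM (id , id)

rightFactor∈𝓜 : ∀ {G H K} (f : Mor G H) (g : Mor H K) (m : MMor G K) → (g ∘M f) ≈M mor m → f ∈𝓜
rightFactor∈𝓜 f g m (pE , pV) =
  (λ {a} {b} q → injE m (trans (sym (pE a)) (trans (cong (fE g) q) (pE b)))) ,
  (λ {a} {b} q → injV m (trans (sym (pV a)) (trans (cong (fV g) q) (pV b))))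

pushout-endo≈idM : ∀ {X A Y P} {f : Mor X A} {g : Mor X Y} {p : Mor A P} {q : Mor Y P} →
                   IsPushout f g p q → (h : Mor P P) → (h ∘M p) ≈M p → (h ∘M q) ≈M q → h ≈M idM
pushout-endo≈idM {P = P} {p = p} {q} po h hp hq
  with IsPushout.universal po P p q (IsPushout.commutes po)
... | h₀ , _ , unique = begin
  h    ≈⟨ unique h hp hq ⟩
  h₀   ≈⟨ unique idM (≈M-refl {f = p}) (≈M-refl {f = q}) ⟨
  idM  ∎
  where open ≈M-Reasoning

-- Each cocone is a cocone of the other span, so the mediating maps are mutually inverse.
pushout-comparison :
  ∀ {X₁ X₂ A Y P₁ P₂}
    {f₁ : Mor X₁ A} {g₁ : Mor X₁ Y} {p₁ : Mor A P₁} {q₁ : Mor Y P₁}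
    {f₂ : Mor X₂ A} {g₂ : Mor X₂ Y} {p₂ : Mor A P₂} {q₂ : Mor Y P₂} →
  IsPushout f₁ g₁ p₁ q₁ → IsPushout f₂ g₂ p₂ q₂ →
  (p₂ ∘M f₁) ≈M (q₂ ∘M g₁) → (p₁ ∘M f₂) ≈M (q₁ ∘M g₂) →
  Σ[ k ∈ MMor P₁ P₂ ] (mor k ∘M q₁) ≈M q₂
pushout-comparison {P₁ = P₁} {P₂} {p₁ = p₁} {q₁} {p₂ = p₂} {q₂} po₁ po₂ cocone₂ cocone₁
  with IsPushout.universal po₁ P₂ p₂ q₂ cocone₂ | IsPushout.universal po₂ P₁ p₁ q₁ cocone₁
... | k , (kp , kq) , _ | k' , (k'p , k'q) , _ = as𝓜 k (rightFactor∈𝓜 k k' id𝓜 k'∘k≈id) , kq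
  where
  k'∘k≈id : (k' ∘M k) ≈M idM
  k'∘k≈id = pushout-endo≈idM po₁ (k' ∘M k)
    (begin (k' ∘M k) ∘M p₁ ≈⟨ ∘M-congˡ k' {k ∘M p₁} {p₂} kp ⟩ k' ∘M p₂ ≈⟨ k'p ⟩ p₁ ∎)
    (begin (k' ∘M k) ∘M q₁ ≈⟨ ∘M-congˡ k' {k ∘M q₁} {q₂} kq ⟩ k' ∘M q₂ ≈⟨ k'q ⟩ q₁ ∎)
    where open ≈M-Reasoning

cocone-precompose :
  ∀ {X₁ X₂ A Y P} (f₁ : Mor X₁ A) (g₁ : Mor X₁ Y) (f₂ : Mor X₂ A) (g₂ : Mor X₂ Y)
    (u : Mor A P) (v : Mor Y P) (h : Mor X₁ X₂) →
  (f₂ ∘M h) ≈M f₁ → (g₂ ∘M h) ≈M g₁ → (u ∘M f₂) ≈M (v ∘M g₂) → (u ∘M f₁) ≈M (v ∘M g₁)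
cocone-precompose f₁ g₁ f₂ g₂ u v h f₂h≈f₁ g₂h≈g₁ cocone = begin
  u ∘M f₁          ≈⟨ ∘M-congˡ u {f₂ ∘M h} {f₁} f₂h≈f₁ ⟨
  u ∘M (f₂ ∘M h)   ≈⟨ ∘M-congʳ h {u ∘M f₂} {v ∘M g₂} cocone ⟩
  v ∘M (g₂ ∘M h)   ≈⟨ ∘M-congˡ v {g₂ ∘M h} {g₁} g₂h≈g₁ ⟩
  v ∘M g₁          ∎
  where open ≈M-Reasoning

inverse-of-bijective : ∀ {G H} (m : MMor G H) →
  StrictlySurjective _≡_ (fE (mor m)) → StrictlySurjective _≡_ (fV (mor m)) →
  Σ[ m⁻¹ ∈ Mor H G ] (m⁻¹ ∘M mor m) ≈M idM × (mor m ∘M m⁻¹) ≈M idM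
inverse-of-bijective {G} {H} m surjE surjV =
  m⁻¹ ,
  ((λ d → injE m (proj₂ (surjE (fE (mor m) d)))) , (λ v → injV m (proj₂ (surjV (fV (mor m) v))))) ,
  ((λ d → proj₂ (surjE d)) , (λ v → proj₂ (surjV v)))
  where
  m⁻¹E : Fin (nE H) → Fin (nE G)
  m⁻¹E d = proj₁ (surjE d)
  m⁻¹V : Fin (nV H) → Fin (nV G)
  m⁻¹V v = proj₁ (surjV v)
  m⁻¹-compat : ∀ d → Joins G (m⁻¹E d) (m⁻¹V (end₁ H d)) (m⁻¹V (end₂ H d))
  m⁻¹-compat d = Joins-reflect m
    (Joins-subst {G = H} (sym (proj₂ (surjE d))) (sym (proj₂ (surjV _))) (sym (proj₂ (surjV _)))
      (inj₁ (refl , refl)))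
  m⁻¹ : Mor H G
  m⁻¹ = record { fE = m⁻¹E ; fV = m⁻¹V ; compat = m⁻¹-compat }

trivialTriple : ∀ {X A Y} (a : MMor X A) (y : MMor X Y) → Triple a y
trivialTriple {X} a y = record
  { X' = X ; x' = id𝓜 ; a' = a ; y' = y ; a'x' = ≈M-refl {f = mor a} ; y'x' = ≈M-refl {f = mor y} }

surjective⇒TripleIso-trivial : ∀ {X A Y} {a : MMor X A} {y : MMor X Y} (t : Triple a y) →
  StrictlySurjective _≡_ (fE (mor (x' t))) → StrictlySurjective _≡_ (fV (mor (x' t))) →
  TripleIso t (trivialTriple a y)
surjective⇒TripleIso-trivial {a = a} {y} t surjE surjV
  with inverse-of-bijective (x' t) surjE surjV
... | φ , φ∘x'≈id , x'∘φ≈id = record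
  { φ = φ ; ψ = mor (x' t) ; ψφ = x'∘φ≈id ; φψ = φ∘x'≈id ; φx' = φ∘x'≈id
  ; a'φ = factor-through-φ (a' t) a (a'x' t)
  ; y'φ = factor-through-φ (y' t) y (y'x' t)
  }
  where
  factor-through-φ : ∀ {B} (b' : MMor (X' t) B) (b : MMor _ B) →
                     mor (b' ∘𝓜 x' t) ≈M mor b → (mor b ∘M φ) ≈M mor b'
  factor-through-φ b' b b'∘x'≈b = begin
    mor b ∘M φ                   ≈⟨ ∘M-congʳ φ {mor b' ∘M mor (x' t)} {mor b} b'∘x'≈b ⟨
    mor b' ∘M (mor (x' t) ∘M φ)  ≈⟨ ∘M-congˡ (mor b') {mor (x' t) ∘M φ} {idM} x'∘φ≈id ⟩
    mor b' ∘M idM                ≈⟨ ≈M-refl {f = mor b'} ⟩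
    mor b'                       ∎
    where open ≈M-Reasoning

⊨⋁C⁺ : ∀ {X Z} {g : MMor X Z} {cs : List (Cond X)} → Any (g ⊨_) cs → g ⊨ ⋁C cs
⊨⋁C⁺ (here g⊨c)  (g⊭c , _)    = g⊭c g⊨c
⊨⋁C⁺ (there g⊨cs) (_ , g⊭⋁cs) = g⊭⋁cs (⊨⋁C⁺ g⊨cs)

⊨⋁C⁻ : ∀ {X Z} {g : MMor X Z} {cs : List (Cond X)} → All (λ c → ¬ g ⊨ c) cs → ¬ g ⊨ ⋁C cs
⊨⋁C⁻ []              g⊨⋁ = g⊨⋁ tt
⊨⋁C⁻ (g⊭c ∷ g⊭cs) g⊨⋁ = g⊨⋁ (g⊭c , ⊨⋁C⁻ g⊭cs)

⊨∃C-along : ∀ {Y P P' Z} {a : MMor Y P} {a' : MMor Y P'} {g : MMor Y Z}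
            (k : MMor P P') → (mor k ∘M mor a) ≈M mor a' → g ⊨ ∃C a' trueC → g ⊨ ∃C a trueC
⊨∃C-along {a = a} {a'} {g = g} k k∘a≈a' (h , h∘a'≈g , _) = h ∘𝓜 k , h∘k∘a≈g , tt
  where
  open ≈M-Reasoning
  h∘k∘a≈g : mor ((h ∘𝓜 k) ∘𝓜 a) ≈M mor g
  h∘k∘a≈g = begin
    mor h ∘M (mor k ∘M mor a)  ≈⟨ ∘M-congˡ (mor h) {mor k ∘M mor a} {mor a'} k∘a≈a' ⟩
    mor h ∘M mor a'            ≈⟨ h∘a'≈g ⟩
    mor g                      ∎

module _ {X A Y B} {a : MMor X A} {y : MMor X Y} (ā : MMor Y B)
         (trivial : (t : Triple a y) → TripleIso t (trivialTriple a y)) where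

  Shifts-∃-trivial : (ȳ : MMor A B) → IsPushout (mor a) (mor y) (mor ȳ) (mor ā) →
                     Shifts y (∃C a trueC) (⋁C (∃C ā trueC ∷ []))
  Shifts-∃-trivial ȳ po = sh-∃ (branch ∷ []) (λ t → here (trivial t)) ([] ∷ [])
    where
    branch : Branch y a trueC
    branch = record { triple = trivialTriple a y ; P = B ; ā = ā ; ȳ = ȳ ; pushout = po
                    ; shifted = trueC ; shift-rec = sh-true }

  module _ {ȳ : Mor A B} (po : IsPushout (mor a) (mor y) ȳ (mor ā)) {Z} (g : MMor Y Z) where

    ⊨Branch⇔⊨∃C : (b : Branch y a trueC) → (g ⊨ Branch.result b) ⇔ (g ⊨ ∃C ā trueC)
    ⊨Branch⇔⊨∃C b@record { triple = t ; ā = ā' ; ȳ = ȳ' ; pushout = po' ; shift-rec = sh-true } =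
      mk⇔ (⊨∃C-along {a = ā} {a' = ā'} {g} (proj₁ B→P') (proj₂ B→P'))
          (⊨∃C-along {a = ā'} {a' = ā} {g} (proj₁ P'→B) (proj₂ P'→B))
      where
      open TripleIso (trivial t)
      cocone-of-po : (ȳ ∘M mor (a' t)) ≈M (mor ā ∘M mor (y' t))
      cocone-of-po = cocone-precompose (mor (a' t)) (mor (y' t)) (mor a) (mor y) ȳ (mor ā) φ
                       a'φ y'φ (IsPushout.commutes po)
      cocone-of-po' : (mor ȳ' ∘M mor a) ≈M (mor ā' ∘M mor y)
      cocone-of-po' = cocone-precompose (mor a) (mor y) (mor (a' t)) (mor (y' t)) (mor ȳ') (mor ā')
                        (mor (x' t)) (a'x' t) (y'x' t) (IsPushout.commutes po')
      P'→B : Σ[ k ∈ MMor (Branch.P b) B ] (mor k ∘M mor ā') ≈M mor ā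
      P'→B = pushout-comparison po' po cocone-of-po cocone-of-po'
      B→P' : Σ[ k ∈ MMor B (Branch.P b) ] (mor k ∘M mor ā) ≈M mor ā'
      B→P' = pushout-comparison po po' cocone-of-po' cocone-of-po

    -- The trivial triple is covered by some branch, so the disjunction is not empty.
    ⊨¬Shift-∃ : ∀ {c} → Shifts y (∃C a trueC) c → (¬ g ⊨ c) ⇔ (¬ g ⊨ ∃C ā trueC)
    ⊨¬Shift-∃ (sh-∃ bs covers _) = mk⇔
      (λ g⊭⋁ g⊨∃ā → g⊭⋁ (⊨⋁C⁺ (Anyₚ.map⁺
        (Any.map (λ {b} _ → Equivalence.from (⊨Branch⇔⊨∃C b) g⊨∃ā) (covers (trivialTriple a y))))))
      (λ g⊭∃ā → ⊨⋁C⁻ (Allₚ.map⁺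
        (All.universal (λ b → g⊭∃ā ∘ Equivalence.to (⊨Branch⇔⊨∃C b)) bs)))

module _ {A₁ A₂ A} {ι : MMor (A₁ ⊕ A₂) A} {e} (bridge : IsBridgeRemoval A₁ A₂ A ι e) where
  open IsBridgeRemoval bridge

  ιV⁻¹ : Fin (nV A) → Fin (nV (A₁ ⊕ A₂))
  ιV⁻¹ v = proj₁ (vertices-onto v)

  ιV-ιV⁻¹ : ∀ v → fV (mor ι) (ιV⁻¹ v) ≡ v
  ιV-ιV⁻¹ v = proj₂ (vertices-onto v)

  ιV⁻¹-ιV : ∀ x → ιV⁻¹ (fV (mor ι) x) ≡ x
  ιV⁻¹-ιV x = injV ι (ιV-ιV⁻¹ (fV (mor ι) x))

  ιE⁻¹ : (d : Fin (nE A)) → d ≢ e → Fin (nE (A₁ ⊕ A₂))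
  ιE⁻¹ d d≢e = proj₁ (others-hit d d≢e)

  ιE-ιE⁻¹ : ∀ d (d≢e : d ≢ e) → fE (mor ι) (ιE⁻¹ d d≢e) ≡ d
  ιE-ιE⁻¹ d d≢e = proj₂ (others-hit d d≢e)

  module _ {Y} (β : MMor (A₁ ⊕ A₂) Y) where

    β⁺V : Fin (nV A) → Fin (nV Y)
    β⁺V = fV (mor β) ∘ ιV⁻¹

    β⁺V-ιV : ∀ x → β⁺V (fV (mor ι) x) ≡ fV (mor β) x
    β⁺V-ιV x = cong (fV (mor β)) (ιV⁻¹-ιV x)

    -- Y with the bridge glued in along β ∘ ι⁻¹ as the new edge zero.
    Y+e : Graph
    Y+e = record
      { nE = suc (nE Y) ; nV = nV Y
      ; end₁ = β⁺V (end₁ A e) Vector.∷ end₁ Y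
      ; end₂ = β⁺V (end₂ A e) Vector.∷ end₂ Y
      }

    β⁺E : Fin (nE A) → Fin (nE Y+e)
    β⁺E d with d ≟ e
    ... | yes _   = zero
    ... | no d≢e = suc (fE (mor β) (ιE⁻¹ d d≢e))

    β⁺-compat : ∀ d → Joins Y+e (β⁺E d) (β⁺V (end₁ A d)) (β⁺V (end₂ A d))
    β⁺-compat d with d ≟ e
    ... | yes refl = inj₁ (refl , refl)
    ... | no d≢e  = SameEnds-trans ends-of-d (compat (mor β) d₀)
      where
      d₀ : Fin (nE (A₁ ⊕ A₂))
      d₀ = ιE⁻¹ d d≢e
      ιd₀≡d : fE (mor ι) d₀ ≡ d
      ιd₀≡d = ιE-ιE⁻¹ d d≢e
      ends-of-d : SameEnds (β⁺V (end₁ A d)) (β⁺V (end₂ A d))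
                           (fV (mor β) (end₁ (A₁ ⊕ A₂) d₀)) (fV (mor β) (end₂ (A₁ ⊕ A₂) d₀))
      ends-of-d = SameEnds-sym
        (SameEnds-subst (β⁺V-ιV _) (β⁺V-ιV _) (cong (β⁺V ∘ end₁ A) ιd₀≡d) (cong (β⁺V ∘ end₂ A) ιd₀≡d)
          (SameEnds-map β⁺V (compat (mor ι) d₀)))

    β⁺E-injective : Injective _≡_ _≡_ β⁺E
    β⁺E-injective {d} {d'} β⁺d≡β⁺d' with d ≟ e | d' ≟ e
    β⁺E-injective _        | yes d≡e | yes d'≡e = trans d≡e (sym d'≡e)
    β⁺E-injective ()       | yes _   | no _
    β⁺E-injective ()       | no _    | yes _
    β⁺E-injective {d} {d'} β⁺d≡β⁺d' | no d≢e | no d'≢e =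
      trans (sym (ιE-ιE⁻¹ d d≢e))
        (trans (cong (fE (mor ι)) (injE β (suc-injective β⁺d≡β⁺d'))) (ιE-ιE⁻¹ d' d'≢e))

    β⁺V-injective : Injective _≡_ _≡_ β⁺V
    β⁺V-injective {v} {v'} β⁺v≡β⁺v' =
      trans (sym (ιV-ιV⁻¹ v)) (trans (cong (fV (mor ι)) (injV β β⁺v≡β⁺v')) (ιV-ιV⁻¹ v'))

    β⁺ : MMor A Y+e
    β⁺ = as𝓜 (record { fE = β⁺E ; fV = β⁺V ; compat = β⁺-compat }) (β⁺E-injective , β⁺V-injective)

    Y↪Y+e : Mor Y Y+e
    Y↪Y+e = record { fE = suc ; fV = id ; compat = λ _ → inj₁ (refl , refl) }

    β⁺E-ιE : ∀ d → β⁺E (fE (mor ι) d) ≡ suc (fE (mor β) d)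
    β⁺E-ιE d with fE (mor ι) d ≟ e
    ... | yes ιd≡e = ⊥-elim (e-not-hit d ιd≡e)
    ... | no ιd≢e = cong (suc ∘ fE (mor β)) (injE ι (ιE-ιE⁻¹ (fE (mor ι) d) ιd≢e))

    β⁺-cocone : (mor β⁺ ∘M mor ι) ≈M (Y↪Y+e ∘M mor β)
    β⁺-cocone = β⁺E-ιE , β⁺V-ιV

    bridge-pushout-leg∈𝓜 : ∀ {B} {β̄ : Mor A B} {ā : Mor Y B} → IsPushout (mor ι) (mor β) β̄ ā → β̄ ∈𝓜
    bridge-pushout-leg∈𝓜 {β̄ = β̄} po with IsPushout.universal po Y+e (mor β⁺) Y↪Y+e β⁺-cocone
    ... | h , (h∘β̄≈β⁺ , _) , _ = rightFactor∈𝓜 β̄ h β⁺ h∘β̄≈β⁺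

  module _ {B₁ B₂} (β₁ : MMor A₁ B₁) (β₂ : MMor A₂ B₂) (t : Triple ι (β₁ ⊕𝓜 β₂)) where

    -- y' would map such an edge to an edge of B₁ + B₂ between its two summands.
    bridge-∉-triple : ∀ d → fE (mor (a' t)) d ≢ e
    bridge-∉-triple d a'd≡e with e-joins
    ... | v₁ , v₂ , e-ends =
      ⊕-no-crossing-edge B₁ B₂ (fE (mor (y' t)) d) (fV (mor β₁) v₁) (fV (mor β₂) v₂) crossing
      where
      u₁ u₂ : Fin (nV (X' t))
      u₁ = fV (mor (x' t)) (inlV {A₁} A₂ v₁)
      u₂ = fV (mor (x' t)) (inrV A₁ {A₂} v₂)
      d-joins : Joins (X' t) d u₁ u₂
      d-joins = Joins-reflect (a' t)
        (Joins-subst {G = A} (sym a'd≡e) (sym (proj₂ (a'x' t) _)) (sym (proj₂ (a'x' t) _))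
          (SameEnds-sym e-ends))
      crossing : Joins (B₁ ⊕ B₂) (fE (mor (y' t)) d)
                       (inlV {B₁} B₂ (fV (mor β₁) v₁)) (inrV B₁ {B₂} (fV (mor β₂) v₂))
      crossing = Joins-subst {G = B₁ ⊕ B₂} refl
        (trans (proj₂ (y'x' t) _) (⊕f-↑ˡ (fV (mor β₁)) (fV (mor β₂)) v₁))
        (trans (proj₂ (y'x' t) _) (⊕f-↑ʳ (fV (mor β₁)) (fV (mor β₂)) v₂))
        (Joins-map (mor (y' t)) d-joins)

    x'-surjectiveE : StrictlySurjective _≡_ (fE (mor (x' t)))
    x'-surjectiveE d with others-hit (fE (mor (a' t)) d) (bridge-∉-triple d)
    ... | d₀ , ιd₀≡a'd = d₀ , injE (a' t) (trans (proj₁ (a'x' t) d₀) ιd₀≡a'd)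

    x'-surjectiveV : StrictlySurjective _≡_ (fV (mor (x' t)))
    x'-surjectiveV u with vertices-onto (fV (mor (a' t)) u)
    ... | w , ιw≡a'u = w , injV (a' t) (trans (proj₂ (a'x' t) w) ιw≡a'u)

    bridge-triple-trivial : TripleIso t (trivialTriple ι (β₁ ⊕𝓜 β₂))
    bridge-triple-trivial = surjective⇒TripleIso-trivial t x'-surjectiveE x'-surjectiveV

lemma6p5 : ∀ (A₁ A₂ A : Graph) (ι : MMor (A₁ ⊕ A₂) A) (e : Fin (nE A)) →
           IsBridgeRemoval A₁ A₂ A ι e →
           ∀ (B₁ B₂ : Graph) (β₁ : MMor A₁ B₁) (β₂ : MMor A₂ B₂) →
           ∀ (B : Graph) (ι' : MMor (B₁ ⊕ B₂) B) (β̄ : Mor A B) →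
           IsPushout (mor ι) (mor (β₁ ⊕𝓜 β₂)) β̄ (mor ι') →
           (Σ[ c' ∈ Cond (B₁ ⊕ B₂) ] Shifts (β₁ ⊕𝓜 β₂) (¬C (∃C ι trueC)) c') ×
           (∀ (c' : Cond (B₁ ⊕ B₂)) →
              Shifts (β₁ ⊕𝓜 β₂) (¬C (∃C ι trueC)) c' →
              ∀ (Z : Graph) (g : MMor (B₁ ⊕ B₂) Z) →
                ((g ⊨ c') → (g ⊨ ¬C (∃C ι' trueC))) ×
                ((g ⊨ ¬C (∃C ι' trueC)) → (g ⊨ c')))
lemma6p5 A₁ A₂ A ι e bridge B₁ B₂ β₁ β₂ B ι' β̄ po =
  (_ , sh-¬ (Shifts-∃-trivial ι' trivial ȳ po)) ,
  λ { _ (sh-¬ shift) _ g → let open Equivalence (⊨¬Shift-∃ ι' trivial po g shift) in to , from }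
  where
  trivial : (t : Triple ι (β₁ ⊕𝓜 β₂)) → TripleIso t (trivialTriple ι (β₁ ⊕𝓜 β₂))
  trivial = bridge-triple-trivial bridge β₁ β₂
  ȳ : MMor A B
  ȳ = as𝓜 β̄ (bridge-pushout-leg∈𝓜 bridge (β₁ ⊕𝓜 β₂) po)
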